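{- For every run $r$ of $\gamma^{\max}$ and all nodes $\alpha,\beta$: (1) $\mathsf{fut}(r,\alpha)\cap\mathsf{past}(r,\alpha)=\{\alpha\}$; and (2) $\alpha\rightsquigarrow\beta$ in $r$ if and only if $\mathsf{fut}(r,\alpha)\cap\mathsf{past}(r,\beta)\neq\emptyset$.
   Context: Model: processes communicate over a directed network; each channel $i\to j$ has an integer upper bound $b_{ij}\ge1$; time is global and discrete; in every run of $\gamma^{\max}$, a message sent on $i\to j$ at time $s$ is received at some time in $[s+1,s+b_{ij}]$. A node $(i,t)$ is process $i$ at time $t$. Syncausality $\rightsquigarrow$ in $r$: the smallest relation on nodes with (1) $(i,t)\rightsquigarrow(i,t')$ if $t\le t'$; (2) $(i,t)\rightsquigarrow(j,t')$ if a message sent at $(i,t)$ is received at $(j,t')$; (3) $(i,t)\rightsquigarrow(j,t+b_{ij})$ if $j$ is a neighbour of $i$ and $i$ sends no message to $j$ at time $t$; (4) transitivity. Cones (viewed as sets of nodes): $\mathsf{fut}(r,\alpha)=\{\theta:\alpha\rightsquigarrow\theta\text{ in }r\}$ and $\mathsf{past}(r,\alpha)=\{\theta:\theta\rightsquigarrow\alpha\text{ in }r\}$. -}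

module Defs where

open import Data.Nat using (ℕ; _≤_; _<_; _+_)
open import Data.Fin using (Fin)
open import Data.Product using (_×_; Σ)
open import Relation.Nullary using (¬_)

record Network : Set₁ where
  field
    n     : ℕ
    Chan  : Fin n → Fin n → Set
    bound : (i j : Fin n) → Chan i j → ℕ
    bound≥1 : (i j : Fin n) (c : Chan i j) → 1 ≤ bound i j c

-- A node (i , t): process i at global time t.
Node : Network → Set
Node N = Fin (Network.n N) × ℕ

-- A run of γ^max, as far as its message pattern is concerned:
-- Msg i j s t  means a message sent on channel i → j at time s is received at time t.
record Run (N : Network) : Set₁ where
  open Network N
  field
    Msg   : Fin n → Fin n → ℕ → ℕ → Set
    valid : ∀ {i j s t} → Msg i j s t →
            Σ (Chan i j) (λ c → (s < t) × (t ≤ s + bound i j c))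

module _ {N : Network} (r : Run N) where
  open Network N
  open Run r

  data _⇝_ : Node N → Node N → Set where
    local : ∀ {i t t'} → t ≤ t' → (i Data.Product., t) ⇝ (i Data.Product., t')
    msg   : ∀ {i j t t'} → Msg i j t t' → (i Data.Product., t) ⇝ (j Data.Product., t')
    silent : ∀ {i j t} (c : Chan i j) → ¬ Σ ℕ (λ t' → Msg i j t t') →
             (i Data.Product., t) ⇝ (j Data.Product., t + bound i j c)
    trans : ∀ {α β γ} → α ⇝ β → β ⇝ γ → α ⇝ γ

  fut : Node N → Node N → Set
  fut α θ = α ⇝ θ

  past : Node N → Node N → Set
  past α θ = θ ⇝ α

-- The key fact is that syncausality never goes back in time: every basic
-- step (local, message delivery, silent bound) strictly advances the clock
-- unless it is the trivial local step, because delivery takes at least one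
-- tick and every bound b_ij is at least 1.  Hence α ⇝ β implies α = β or
-- time(α) < time(β).  From this, ⇝ is antisymmetric, and it is reflexive by
-- rule (1); so ⇝ is a partial order on nodes.
--
-- The theorem then follows: (1) θ lies in fut(α) ∩ past(α) iff α ⇝ θ ⇝ α,
-- iff θ = α by antisymmetry and reflexivity; (2) fut(α) ∩ past(β) is
-- inhabited iff α ⇝ β, by transitivity in one direction and by taking the
-- witness θ = β (reflexivity) in the other.
module Submission where

open import Defs
open import Data.Product using (_×_; Σ; _,_; proj₂)
open import Data.Sum using (_⊎_; inj₁; inj₂)
open import Data.Nat using (ℕ; _<_)
open import Data.Nat.Properties using (≤-refl; <-trans; <-irrefl; m<m+n; m≤n⇒m<n∨m≡n)
open import Data.Empty using (⊥-elim)
open import Relation.Binary.PropositionalEquality using (_≡_; refl; sym)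
open import Function.Bundles using (_⇔_; mk⇔)

module _ {N : Network} (r : Run N) where
  open Network N using (bound≥1)
  open Run r using (valid)

  time : Node N → ℕ
  time = proj₂

  ⇝-refl : ∀ {α} → _⇝_ r α α
  ⇝-refl {i , t} = local ≤-refl

  -- Syncausality respects time: a syncausal pair is either the same node or
  -- strictly later in time.  Messages take ≥ 1 tick and b_ij ≥ 1.
  ⇝-advances : ∀ {α β} → _⇝_ r α β → (α ≡ β) ⊎ (time α < time β)
  ⇝-advances (local t≤t') with m≤n⇒m<n∨m≡n t≤t'
  ... | inj₁ t<t' = inj₂ t<t'
  ... | inj₂ refl = inj₁ refl
  ⇝-advances (msg m) with valid m
  ... | _ , s<t , _ = inj₂ s<t
  ⇝-advances (silent {i} {j} {t} c _) = inj₂ (m<m+n t (bound≥1 i j c))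
  ⇝-advances (trans p q) with ⇝-advances p | ⇝-advances q
  ... | inj₁ refl | later = later
  ... | inj₂ lt   | inj₁ refl = inj₂ lt
  ... | inj₂ lt   | inj₂ lt'  = inj₂ (<-trans lt lt')

  ⇝-antisym : ∀ {α β} → _⇝_ r α β → _⇝_ r β α → α ≡ β
  ⇝-antisym p q with ⇝-advances p | ⇝-advances q
  ... | inj₁ α≡β | _         = α≡β
  ... | inj₂ _   | inj₁ β≡α  = sym β≡α
  ... | inj₂ lt  | inj₂ lt'  = ⊥-elim (<-irrefl refl (<-trans lt lt'))

  cones-meet-at-apex : (α θ : Node N) → (fut r α θ × past r α θ) ⇔ (θ ≡ α)
  cones-meet-at-apex α θ =
    mk⇔ (λ (α⇝θ , θ⇝α) → ⇝-antisym θ⇝α α⇝θ)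
        (λ { refl → ⇝-refl , ⇝-refl })

  ⇝-iff-cones-meet : (α β : Node N) →
    (_⇝_ r α β) ⇔ Σ (Node N) (λ θ → fut r α θ × past r β θ)
  ⇝-iff-cones-meet α β =
    mk⇔ (λ α⇝β → β , α⇝β , ⇝-refl)
        (λ (θ , α⇝θ , θ⇝β) → trans α⇝θ θ⇝β)

mainTheorem8 : (N : Network) (r : Run N) (α β : Node N) →
    ((θ : Node N) → ((fut r α θ × past r α θ) ⇔ (θ ≡ α)))
    × ((_⇝_ r α β) ⇔ Σ (Node N) (λ θ → fut r α θ × past r β θ))
mainTheorem8 N r α β = cones-meet-at-apex r α , ⇝-iff-cones-meet r α β
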